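{- (a) Every graph $G$ with $v(G) \ge 3$ satisfies $\tau_4(G) \le v(G) - 3$. (b) Consequently, for every $t \ge 1$, every graph $H \in \mathcal H_t$ (with $r = 4$) has exactly $t+3$ vertices and satisfies $\tau_4(H) = t$, and every graph $G$ with $\tau_4(G) = t$ has at least $t+3$ vertices; that is, the members of $\mathcal H_t$ are vertex-minimal among graphs with $\tau_4(G) = t$.
   Context: $K_4$-bootstrap percolation: starting from a graph $G$ on vertex set $V$, set $G_0 := G$ and $G_{t+1} := G_t \cup \{e \in \binom{V}{2} : e \text{ is the only edge missing from } G_t \text{ in some copy of } K_4\}$; $\langle G \rangle_t := G_t$, and the saturation time is $\tau_4(G) := \min\{t \ge 0 : G_t = \bigcup_{s} G_s\}$. The family $\mathcal H_t$ (for $r=4$): the body $H_0$ is a triangle $K_3$ on $V_0$; $\mathcal H_1 = \{K_4 - e\}$, i.e. $H_1$ is $H_0$ plus a vertex $v_1$ adjacent to exactly $2$ vertices of $V_0$, and $v_0$ is a vertex of $V_0$ adjacent to $v_1$. For $t \ge 2$, $H_t \in \mathcal H_t$ has vertex set $V_t = V_{t-1} \cup \{v_t\}$ and satisfies: (i) $H_t[V_{t-1}] \in \mathcal H_{t-1}$ (with distinguished vertices $v_1, \dots, v_{t-1}$); (ii) $v_{t-1} \in N(v_t)$; (iii) $|N(v_t)| = 2$; (iv) $N(v_t) \setminus \{v_{t-1}\} \not\subseteq N(v_{t-1})$. -}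

module Defs where

open import Data.Nat using (ℕ; zero; suc; _<_)
open import Data.Bool using (Bool; true; false; _∧_; _∨_; not)
open import Data.Fin using (Fin; _≟_)
open import Data.Bool.ListAction using (any)
open import Data.List using (List; []; _∷_; allFin; filterᵇ; length)
open import Data.List.Membership.Propositional using (_∈_; _∉_)
open import Data.Product using (Σ; _×_; ∃-syntax)
open import Relation.Nullary using (¬_)
open import Relation.Nullary.Decidable using (⌊_⌋)
open import Relation.Binary.PropositionalEquality using (_≡_)

Adj : ℕ → Set
Adj n = Fin n → Fin n → Bool

record IsSimpleGraph {n : ℕ} (E : Adj n) : Set where
  field
    sym   : ∀ u v → E u v ≡ E v u
    irrefl : ∀ v → E v v ≡ false

_≠ᵇ_ : ∀ {n} → Fin n → Fin n → Bool
u ≠ᵇ v = not ⌊ u ≟ v ⌋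

K4completes : ∀ {n} → Adj n → Fin n → Fin n → Bool
K4completes {n} E u v =
  any (λ w → any (λ x →
        (u ≠ᵇ v) ∧ (u ≠ᵇ w) ∧ (u ≠ᵇ x) ∧ (v ≠ᵇ w) ∧ (v ≠ᵇ x) ∧ (w ≠ᵇ x)
        ∧ E u w ∧ E u x ∧ E v w ∧ E v x ∧ E w x)
      (allFin n)) (allFin n)

step : ∀ {n} → Adj n → Adj n
step E u v = E u v ∨ K4completes E u v

iter : ∀ {n} → Adj n → ℕ → Adj n
iter E zero = E
iter E (suc t) = step (iter E t)

-- G_t = ⋃_s G_s   (the inclusion G_t ⊆ ⋃_s G_s is trivial)
SaturatedAt : ∀ {n} → Adj n → ℕ → Set
SaturatedAt E t = ∀ s u v → iter E s u v ≡ true → iter E t u v ≡ true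

SatTime : ∀ {n} → Adj n → ℕ → Set
SatTime E t = SaturatedAt E t × (∀ t' → t' < t → ¬ SaturatedAt E t')

nbrCount : ∀ {n} → Adj n → Fin n → List (Fin n) → ℕ
nbrCount E v L = length (filterᵇ (E v) L)

-- IsH E t L : the induced subgraph of E on the vertices of L is a member
-- of 𝓗_t, where L lists V_t in reverse order  v_t ∷ … ∷ v_1 ∷ V_0.
data IsH {n : ℕ} (E : Adj n) : ℕ → List (Fin n) → Set where
  body : ∀ a b c → a ≠ᵇ b ≡ true → b ≠ᵇ c ≡ true → a ≠ᵇ c ≡ true →
         E a b ≡ true → E b c ≡ true → E a c ≡ true →
         IsH E 0 (c ∷ b ∷ a ∷ [])
  first : ∀ v L → IsH E 0 L → v ∉ L → nbrCount E v L ≡ 2 →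
          IsH E 1 (v ∷ L)
  next : ∀ t v u L →
         IsH E (suc t) (u ∷ L) →
         v ∉ (u ∷ L) →
         E v u ≡ true →
         nbrCount E v (u ∷ L) ≡ 2 →
         (∃[ w ] (w ∈ L × E v w ≡ true × E u w ≡ false)) →
         IsH E (suc (suc t)) (v ∷ u ∷ L)

InFamilyH : ∀ {n} → ℕ → Adj n → Set
InFamilyH {n} t E = Σ (List (Fin n)) λ L → IsH E t L × (∀ x → x ∈ L)

-- (a) Call uv fresh at time t if it is an edge of G_{t+1} but not of G_t. It is completed by a copy of
-- K₄⁻ in G_t, and for t > 0 one of the five edges pq of that copy is itself fresh at time t − 1.
-- Inductively, a fresh edge uv comes with a clique K of G_{t+1} on at least t + 4 vertices such that
-- K ∪ {u, v} is a clique of G_{t+2}: the clique K′ ∪ {p, q} obtained for pq and the four corners of the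
-- copy share p and q, so they merge one step later, while K′ grows by one vertex, namely by p or q, or by
-- a corner with two neighbours in K′. So no edge is fresh at time n − 3, whence τ₄(G) ≤ n − 3, and
-- τ₄(G) = t forces n ≥ t + 3.
-- (b) For H ∈ 𝓗_t let V_s = V₀ ∪ {v_1, …, v_s}. Inductively G_s ⊆ E(H) ∪ V_s²: a vertex v_j ∉ V_{s+1}
-- lies in no copy of K₄⁻ inside E(H) ∪ V_s², since it has only the two neighbours v_{j−1} and w, and
-- these are not adjacent there. As G_t is complete on V_t, v_t and a vertex of V_{t−1} not adjacent to
-- it form an edge that is fresh at time t − 1; so τ₄(H) = t, and v(H) = t + 3 by (a).

module Submission where

open import Defs
open import Data.Nat using (ℕ; zero; suc; _≤_; _<_; _+_; _∸_; z≤n; s≤s; _≤?_)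
open import Data.Nat.Properties
  using (≤-trans; ≤-refl; ≤-pred; ≤-antisym; n≤1+n; m≤n+m; m≤m+n; +-suc; m∸n+n≡m; <-irrefl; ≰⇒>; m≤n⇒m<n∨m≡n; +-identityʳ)
open import Data.Bool using (Bool; true; false; _∧_; _∨_; T; T?)
import Data.Bool as Bool
open import Data.Bool.Properties using (T-≡; T-∧; ¬-not)
open import Data.Fin using (Fin; _≟_)
open import Data.Fin.Properties using (all?; ¬∀⟶∃¬)
open import Data.List using (List; []; _∷_; allFin; filterᵇ; length)
open import Data.List.Relation.Unary.Any using (satisfied)
open import Data.List.Relation.Unary.Any.Properties using (any⁺; any⁻)
open import Data.List.Membership.Propositional using (lose)
open import Data.List.Membership.Propositional.Properties using (∈-allFin)
open import Data.Product using (_×_; _,_; proj₁; proj₂; ∃₂; ∃-syntax)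
open import Data.Sum using (_⊎_; inj₁; inj₂)
open import Data.Empty using (⊥; ⊥-elim)
open import Function using (_∘_; Equivalence)
open import Level using (0ℓ)
open import Relation.Nullary using (¬_; Dec; yes; no)
open import Relation.Nullary.Decidable using (toWitnessFalse; fromWitnessFalse; _×-dec_; ¬?; decidable-stable; map′)
open import Relation.Unary using (Pred; Decidable; _⊆_)
open import Relation.Binary using (Rel; Symmetric; _⇒_)
open import Relation.Binary.PropositionalEquality using (_≡_; _≢_; refl; sym; trans; cong; subst)

open Equivalence using (to; from)

private variable
  n : ℕ

Edge : Adj n → Rel (Fin n) 0ℓ
Edge F u v = F u v ≡ true

true≢false : ∀ {b} → b ≡ true → b ≢ false
true≢false refl ()

≠ᵇ⇒≢ : {u v : Fin n} → u ≠ᵇ v ≡ true → u ≢ v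
≠ᵇ⇒≢ = toWitnessFalse ∘ from T-≡

record K4⁻ {ℓ} {A : Set} (R : Rel A ℓ) (u v w x : A) : Set ℓ where
  field
    u≢v : u ≢ v
    u≢w : u ≢ w
    u≢x : u ≢ x
    v≢w : v ≢ w
    v≢x : v ≢ x
    w≢x : w ≢ x
    uw : R u w
    ux : R u x
    vw : R v w
    vx : R v x
    wx : R w x

module _ {ℓ} {A : Set} {R : Rel A ℓ} {u v w x : A} where

  K4⁻-map : ∀ {ℓ′} {R′ : Rel A ℓ′} → (∀ {a b} → R a b → R′ a b) → K4⁻ R u v w x → K4⁻ R′ u v w x
  K4⁻-map f k = record
    { u≢v = u≢v ; u≢w = u≢w ; u≢x = u≢x ; v≢w = v≢w ; v≢x = v≢x ; w≢x = w≢x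
    ; uw = f uw ; ux = f ux ; vw = f vw ; vx = f vx ; wx = f wx }
    where open K4⁻ k

  K4⁻-swap-ends : K4⁻ R u v w x → K4⁻ R v u w x
  K4⁻-swap-ends k = record
    { u≢v = u≢v ∘ sym ; u≢w = v≢w ; u≢x = v≢x ; v≢w = u≢w ; v≢x = u≢x ; w≢x = w≢x
    ; uw = vw ; ux = vx ; vw = uw ; vx = ux ; wx = wx }
    where open K4⁻ k

  K4⁻-swap-sides : Symmetric R → K4⁻ R u v w x → K4⁻ R u v x w
  K4⁻-swap-sides R-sym k = record
    { u≢v = u≢v ; u≢w = u≢x ; u≢x = u≢w ; v≢w = v≢x ; v≢x = v≢w ; w≢x = w≢x ∘ sym
    ; uw = ux ; ux = uw ; vw = vx ; vx = vw ; wx = R-sym wx }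
    where open K4⁻ k

module _ {F : Adj n} {u v : Fin n} where

  K4completes⇒K4⁻ : K4completes F u v ≡ true → ∃₂ (K4⁻ (Edge F) u v)
  K4completes⇒K4⁻ c =
    let w , c₁ = satisfied (any⁻ _ (allFin n) (from T-≡ c))
        x , c₂ = satisfied (any⁻ _ (allFin n) c₁)
        uv , c₃ = to T-∧ c₂ ; uw , c₄ = to T-∧ c₃ ; ux , c₅ = to T-∧ c₄
        vw , c₆ = to T-∧ c₅ ; vx , c₇ = to T-∧ c₆ ; wx , c₈ = to T-∧ c₇
        Euw , c₉ = to T-∧ c₈ ; Eux , c₁₀ = to T-∧ c₉ ; Evw , c₁₁ = to T-∧ c₁₀
        Evx , Ewx = to T-∧ c₁₁
    in w , x , record
      { u≢v = ≠ᵇ⇒≢ (to T-≡ uv) ; u≢w = ≠ᵇ⇒≢ (to T-≡ uw) ; u≢x = ≠ᵇ⇒≢ (to T-≡ ux)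
      ; v≢w = ≠ᵇ⇒≢ (to T-≡ vw) ; v≢x = ≠ᵇ⇒≢ (to T-≡ vx) ; w≢x = ≠ᵇ⇒≢ (to T-≡ wx)
      ; uw = to T-≡ Euw ; ux = to T-≡ Eux ; vw = to T-≡ Evw ; vx = to T-≡ Evx ; wx = to T-≡ Ewx }

  K4⁻⇒K4completes : ∀ {w x} → K4⁻ (Edge F) u v w x → K4completes F u v ≡ true
  K4⁻⇒K4completes {w} {x} k = to T-≡ (any⁺ _ (lose (∈-allFin w) (any⁺ _ (lose (∈-allFin x)
    (conj (apart u≢v) (conj (apart u≢w) (conj (apart u≢x) (conj (apart v≢w) (conj (apart v≢x) (conj (apart w≢x)
      (conj (from T-≡ uw) (conj (from T-≡ ux) (conj (from T-≡ vw) (conj (from T-≡ vx) (from T-≡ wx)))))))))))))))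
    where
    open K4⁻ k
    conj : ∀ {a b} → T a → T b → T (a ∧ b)
    conj p q = from T-∧ (p , q)
    apart : ∀ {a b : Fin n} → a ≢ b → T (a ≠ᵇ b)
    apart = fromWitnessFalse

module _ (F : Adj n) where

  step-inflationary : Edge F ⇒ Edge (step F)
  step-inflationary {u} {v} e = subst (λ b → b ∨ K4completes F u v ≡ true) (sym e) refl

  K4⁻⇒step : ∀ {u v w x} → K4⁻ (Edge F) u v w x → Edge (step F) u v
  K4⁻⇒step {u} {v} k with F u v
  ... | true  = refl
  ... | false = K4⁻⇒K4completes k

  step⇒ : ∀ {u v} → Edge (step F) u v → Edge F u v ⊎ ∃₂ (K4⁻ (Edge F) u v)
  step⇒ {u} {v} e with F u v
  ... | true  = inj₁ refl
  ... | false = inj₂ (K4completes⇒K4⁻ e)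

  step-sym : Symmetric (Edge F) → Symmetric (Edge (step F))
  step-sym F-sym {u} {v} e with step⇒ e
  ... | inj₁ e′ = step-inflationary (F-sym e′)
  ... | inj₂ (_ , _ , k) = K4⁻⇒step (K4⁻-swap-ends k)

  step-loopless : (∀ {u v} → Edge F u v → u ≢ v) → ∀ {u v} → Edge (step F) u v → u ≢ v
  step-loopless F-loopless e with step⇒ e
  ... | inj₁ e′ = F-loopless e′
  ... | inj₂ (_ , _ , k) = K4⁻.u≢v k

step-mono : (F F′ : Adj n) → Edge F ⇒ Edge F′ → Edge (step F) ⇒ Edge (step F′)
step-mono F F′ F⊆F′ e with step⇒ F e
... | inj₁ e′ = step-inflationary F′ (F⊆F′ e′)
... | inj₂ (_ , _ , k) = K4⁻⇒step F′ (K4⁻-map F⊆F′ k)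

module _ (E : Adj n) where

  iter-mono : ∀ {s s′} → s ≤ s′ → Edge (iter E s) ⇒ Edge (iter E s′)
  iter-mono {zero}  {zero}   z≤n      e = e
  iter-mono {zero}  {suc s′} z≤n      e = step-inflationary (iter E s′) (iter-mono {zero} {s′} z≤n e)
  iter-mono {suc s} {suc s′} (s≤s le) e = step-mono (iter E s) (iter E s′) (iter-mono le) e

  iter-sym : Symmetric (Edge E) → ∀ s → Symmetric (Edge (iter E s))
  iter-sym E-sym zero    = E-sym
  iter-sym E-sym (suc s) = step-sym (iter E s) (iter-sym E-sym s)

  iter-loopless : (∀ {u v} → Edge E u v → u ≢ v) → ∀ s {u v} → Edge (iter E s) u v → u ≢ v
  iter-loopless E-loopless zero    = E-loopless
  iter-loopless E-loopless (suc s) = step-loopless (iter E s) (iter-loopless E-loopless s)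

  stationary⇒saturated : ∀ {t} → Edge (iter E (suc t)) ⇒ Edge (iter E t) → SaturatedAt E t
  stationary⇒saturated {t} back s u v e = stays s (iter-mono (m≤m+n s t) {u} {v} e)
    where
    stays : ∀ k → Edge (iter E (k + t)) ⇒ Edge (iter E t)
    stays zero    e = e
    stays (suc k) {a} {b} e = back (step-mono (iter E (k + t)) (iter E t) (stays k) {a} {b} e)

IsClique : ∀ {ℓ} → Adj n → Pred (Fin n) ℓ → Set ℓ
IsClique F P = ∀ {x y} → P x → P y → x ≢ y → Edge F x y

module _ {ℓ} (F : Adj n) {P : Pred (Fin n) ℓ} where

  clique-⊆ : ∀ {ℓ′} {Q : Pred (Fin n) ℓ′} → Q ⊆ P → IsClique F P → IsClique F Q
  clique-⊆ Q⊆P clique qx qy = clique (Q⊆P qx) (Q⊆P qy)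

  clique-step : IsClique F P → IsClique (step F) P
  clique-step clique px py x≢y = step-inflationary F (clique px py x≢y)

  clique-insert : ∀ {y} → Symmetric (Edge F) → IsClique F P → (∀ {z} → P z → y ≢ z → Edge F y z) →
                  IsClique F (λ z → z ≡ y ⊎ P z)
  clique-insert F-sym clique y∼P (inj₁ refl) (inj₁ refl) x≢y = ⊥-elim (x≢y refl)
  clique-insert F-sym clique y∼P (inj₁ refl) (inj₂ pz)   x≢z = y∼P pz x≢z
  clique-insert F-sym clique y∼P (inj₂ pz)   (inj₁ refl) z≢y = F-sym (y∼P pz (z≢y ∘ sym))
  clique-insert F-sym clique y∼P (inj₂ px)   (inj₂ pz)   x≢z = clique px pz x≢z

module _ {ℓ} (F : Adj n) {P : Pred (Fin n) ℓ} where

  -- y is joined to each other member z through the K₄ on y, z, a, b.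
  clique-extend : ∀ {y a b} → Symmetric (Edge F) → IsClique F P → ¬ P y → P a → P b → a ≢ b →
                  Edge F y a → Edge F y b → IsClique (step F) (λ z → z ≡ y ⊎ P z)
  clique-extend {y} {a} {b} F-sym clique ¬py pa pb a≢b ya yb =
    clique-insert (step F) (step-sym F F-sym) (clique-step F clique) y∼P
    where
    y∼P : ∀ {z} → P z → y ≢ z → Edge (step F) y z
    y∼P {z} pz y≢z with z ≟ a | z ≟ b
    ... | yes refl | _        = step-inflationary F ya
    ... | no _     | yes refl = step-inflationary F yb
    ... | no z≢a   | no z≢b   = K4⁻⇒step F record
      { u≢v = y≢z ; u≢w = λ { refl → ¬py pa } ; u≢x = λ { refl → ¬py pb } ; v≢w = z≢a ; v≢x = z≢b ; w≢x = a≢b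
      ; uw = ya ; ux = yb ; vw = clique pz pa z≢a ; vx = clique pz pb z≢b ; wx = clique pa pb a≢b }

  -- x ∈ P ∖ Q and y ∈ Q ∖ P are joined through the K₄ on x, y, a, b.
  clique-merge : ∀ {Q : Pred (Fin n) ℓ} {a b} → Symmetric (Edge F) → Decidable P → Decidable Q →
                 IsClique F P → IsClique F Q → P a → Q a → P b → Q b → a ≢ b →
                 IsClique (step F) (λ z → P z ⊎ Q z)
  clique-merge {Q} {a} {b} F-sym P? Q? P-clique Q-clique pa qa pb qb a≢b = merged
    where
    across : ∀ {x y} → P x → Q y → x ≢ y → Edge (step F) x y
    across {x} {y} px qy x≢y with Q? x | P? y
    ... | yes qx | _      = step-inflationary F (Q-clique qx qy x≢y)
    ... | no _   | yes py = step-inflationary F (P-clique px py x≢y)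
    ... | no ¬qx | no ¬py = K4⁻⇒step F record
      { u≢v = x≢y ; u≢w = λ { refl → ¬qx qa } ; u≢x = λ { refl → ¬qx qb }
      ; v≢w = λ { refl → ¬py pa } ; v≢x = λ { refl → ¬py pb } ; w≢x = a≢b
      ; uw = P-clique px pa λ { refl → ¬qx qa } ; ux = P-clique px pb λ { refl → ¬qx qb }
      ; vw = Q-clique qy qa λ { refl → ¬py pa } ; vx = Q-clique qy qb λ { refl → ¬py pb }
      ; wx = P-clique pa pb a≢b }
    merged : IsClique (step F) (λ z → P z ⊎ Q z)
    merged (inj₁ px) (inj₁ py) x≢y = step-inflationary F (P-clique px py x≢y)
    merged (inj₂ qx) (inj₂ qy) x≢y = step-inflationary F (Q-clique qx qy x≢y)
    merged (inj₁ px) (inj₂ qy) x≢y = across px qy x≢y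
    merged (inj₂ qx) (inj₁ py) x≢y = step-sym F F-sym (across py qx (x≢y ∘ sym))

Corner : Fin n → Fin n → Fin n → Fin n → Pred (Fin n) 0ℓ
Corner u v w x z = z ≡ u ⊎ z ≡ v ⊎ z ≡ w ⊎ z ≡ x

pattern at-u = inj₁ refl
pattern at-v = inj₂ (inj₁ refl)
pattern at-w = inj₂ (inj₂ (inj₁ refl))
pattern at-x = inj₂ (inj₂ (inj₂ refl))

module _ {u v w x : Fin n} where

  corner-swap-ends : Corner v u w x ⊆ Corner u v w x
  corner-swap-ends at-u = at-v
  corner-swap-ends at-v = at-u
  corner-swap-ends at-w = at-w
  corner-swap-ends at-x = at-x

  corner-swap-sides : Corner u v x w ⊆ Corner u v w x
  corner-swap-sides at-u = at-u
  corner-swap-sides at-v = at-v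
  corner-swap-sides at-w = at-x
  corner-swap-sides at-x = at-w

K4⁻-clique : {F : Adj n} {u v w x : Fin n} → Symmetric (Edge F) → K4⁻ (Edge F) u v w x →
             IsClique (step F) (Corner u v w x)
K4⁻-clique {F = F} F-sym k = clique
  where
  open K4⁻ k
  up : Edge F ⇒ Edge (step F)
  up = step-inflationary F
  clique : IsClique (step F) (Corner _ _ _ _)
  clique at-u at-u ne = ⊥-elim (ne refl)
  clique at-u at-v _  = K4⁻⇒step F k
  clique at-u at-w _  = up uw
  clique at-u at-x _  = up ux
  clique at-v at-u _  = step-sym F F-sym (K4⁻⇒step F k)
  clique at-v at-v ne = ⊥-elim (ne refl)
  clique at-v at-w _  = up vw
  clique at-v at-x _  = up vx
  clique at-w at-u _  = up (F-sym uw)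
  clique at-w at-v _  = up (F-sym vw)
  clique at-w at-w ne = ⊥-elim (ne refl)
  clique at-w at-x _  = up wx
  clique at-x at-u _  = up (F-sym ux)
  clique at-x at-v _  = up (F-sym vx)
  clique at-x at-w _  = up (F-sym wx)
  clique at-x at-x ne = ⊥-elim (ne refl)

least-satisfying : ∀ {ℓ} {P : Pred ℕ ℓ} → Decidable P → ∀ {m} → P m →
                   ∃[ t ] (P t × t ≤ m × (∀ t′ → t′ < t → ¬ P t′))
least-satisfying {P = P} P? {m} pm =
  subst Least (+-identityʳ m) (search m 0 (λ _ ()) (subst P (sym (+-identityʳ m)) pm))
  where
  Least : ℕ → Set _
  Least b = ∃[ t ] (P t × t ≤ b × (∀ t′ → t′ < t → ¬ P t′))
  search : ∀ k t → (∀ t′ → t′ < t → ¬ P t′) → P (k + t) → Least (k + t)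
  search k t below p with P? t
  ... | yes pt = t , pt , m≤n+m t k , below
  search zero    t below p | no ¬pt = ⊥-elim (¬pt p)
  search (suc k) t below p | no ¬pt =
    subst Least (+-suc k t) (search k (suc t) below′ (subst P (sym (+-suc k t)) p))
    where
    below′ : ∀ t′ → t′ < suc t → ¬ P t′
    below′ t′ t′<1+t with m≤n⇒m<n∨m≡n (≤-pred t′<1+t)
    ... | inj₁ t′<t = below t′ t′<t
    ... | inj₂ refl = ¬pt

record Fresh (E : Adj n) (t : ℕ) (u v : Fin n) : Set where
  constructor fresh
  field
    new : Edge (iter E (suc t)) u v
    old : iter E t u v ≡ false

module _ (E : Adj n) where

  fresh? : ∀ t u v → Dec (Fresh E t u v)
  fresh? t u v = map′ (λ (e , o) → fresh e o) (λ (fresh e o) → e , o)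
    ((iter E (suc t) u v Bool.≟ true) ×-dec (iter E t u v Bool.≟ false))

  edge-or-fresh : ∀ {t u v} → Edge (iter E (suc t)) u v → Edge (iter E t) u v ⊎ Fresh E t u v
  edge-or-fresh {t} {u} {v} e with iter E t u v Bool.≟ true
  ... | yes e′ = inj₁ e′
  ... | no ¬e′ = inj₂ (fresh e (¬-not ¬e′))

  fresh⇒K4⁻ : ∀ {t u v} → Fresh E t u v → ∃₂ (K4⁻ (Edge (iter E t)) u v)
  fresh⇒K4⁻ (fresh new old) with step⇒ _ new
  ... | inj₁ e = ⊥-elim (true≢false e old)
  ... | inj₂ k = k

  fresh⇒unsaturated : ∀ {t t′ u v} → Fresh E t u v → t′ ≤ t → ¬ SaturatedAt E t′
  fresh⇒unsaturated {t} {u = u} {v} (fresh new old) t′≤t saturated =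
    true≢false (iter-mono E t′≤t {u} {v} (saturated (suc t) u v new)) old

  Quiescent : ℕ → Set
  Quiescent t = ∀ u v → ¬ Fresh E t u v

  quiescent? : ∀ t → Dec (Quiescent t)
  quiescent? t = all? λ u → all? λ v → ¬? (fresh? t u v)

  quiescent⇒saturated : ∀ {t} → Quiescent t → SaturatedAt E t
  quiescent⇒saturated {t} quiet = stationary⇒saturated E {t} back
    where
    back : Edge (iter E (suc t)) ⇒ Edge (iter E t)
    back {u} {v} e with edge-or-fresh e
    ... | inj₁ e′ = e′
    ... | inj₂ f  = ⊥-elim (quiet u v f)

  unsaturated⇒fresh : ∀ {t} → ¬ SaturatedAt E t → ∃₂ (Fresh E t)
  unsaturated⇒fresh {t} unsat =
    let u , ¬quiet-u = ¬∀⟶∃¬ n _ (λ u → all? λ v → ¬? (fresh? t u v)) (unsat ∘ quiescent⇒saturated)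
        v , ¬¬fresh  = ¬∀⟶∃¬ n _ (λ v → ¬? (fresh? t u v)) ¬quiet-u
    in u , v , decidable-stable (fresh? t u v) ¬¬fresh

  quiescent⇒saturation-time : ∀ {m} → Quiescent m → ∃[ t ] (SatTime E t × t ≤ m)
  quiescent⇒saturation-time quiet =
    let t , quiet-t , t≤m , below = least-satisfying quiescent? quiet
    in t , (quiescent⇒saturated quiet-t ,
            λ t′ t′<t sat → below t′ t′<t λ u v f → fresh⇒unsaturated f ≤-refl sat) , t≤m

  saturation-time⇒fresh : ∀ {t} → SatTime E (suc t) → ∃₂ (Fresh E t)
  saturation-time⇒fresh (_ , minimal) = unsaturated⇒fresh (minimal _ ≤-refl)

module CliqueGrowth {E : Adj n} (E-sym : Symmetric (Edge E)) where

  open import Data.Fin.Subset using (Subset; ⁅_⁆; _∪_; ∣_∣; _∈_; _∉_; _⊂_)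
  open import Data.Fin.Subset.Properties
    using (_∈?_; x∈p∪q⁺; x∈p∪q⁻; p⊆p∪q; x∈⁅x⁆; x∈⁅y⁆⇒x≡y; x≢y⇒x∉⁅y⁆; ∣⁅x⁆∣≡1; p⊂q⇒∣p∣<∣q∣; ∣p∣≤n)

  ∉-∪ : ∀ {z} {p q : Subset n} → z ∉ p → z ∉ q → z ∉ p ∪ q
  ∉-∪ {p = p} {q} z∉p z∉q z∈ with x∈p∪q⁻ p q z∈
  ... | inj₁ z∈p = z∉p z∈p
  ... | inj₂ z∈q = z∉q z∈q

  ∣p∣<∣p∪⁅x⁆∣ : ∀ {x} {p : Subset n} → x ∉ p → ∣ p ∣ < ∣ p ∪ ⁅ x ⁆ ∣
  ∣p∣<∣p∪⁅x⁆∣ {x} x∉p = p⊂q⇒∣p∣<∣q∣ (p⊆p∪q _ , x , x∈p∪q⁺ (inj₂ (x∈⁅x⁆ x)) , x∉p)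

  ∪-pair-⊆ : ∀ {ℓ} {P : Pred (Fin n) ℓ} {K u v} → (_∈ K) ⊆ P → P u → P v → (_∈ K ∪ ⁅ u ⁆ ∪ ⁅ v ⁆) ⊆ P
  ∪-pair-⊆ {K = K} {u} {v} K⊆P pu pv z∈ with x∈p∪q⁻ K _ z∈
  ... | inj₁ z∈K = K⊆P z∈K
  ... | inj₂ z∈uv with x∈p∪q⁻ ⁅ u ⁆ ⁅ v ⁆ z∈uv
  ...   | inj₁ z∈u rewrite x∈⁅y⁆⇒x≡y u z∈u = pu
  ...   | inj₂ z∈v rewrite x∈⁅y⁆⇒x≡y v z∈v = pv

  corners : Fin n → Fin n → Fin n → Fin n → Subset n
  corners u v w x = ((⁅ u ⁆ ∪ ⁅ v ⁆) ∪ ⁅ w ⁆) ∪ ⁅ x ⁆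

  module _ {u v w x : Fin n} where

    ∈-corners⁻ : ∀ {z} → z ∈ corners u v w x → Corner u v w x z
    ∈-corners⁻ z∈ with x∈p∪q⁻ _ _ z∈
    ... | inj₂ z∈x = inj₂ (inj₂ (inj₂ (x∈⁅y⁆⇒x≡y _ z∈x)))
    ... | inj₁ z∈uvw with x∈p∪q⁻ _ _ z∈uvw
    ...   | inj₂ z∈w = inj₂ (inj₂ (inj₁ (x∈⁅y⁆⇒x≡y _ z∈w)))
    ...   | inj₁ z∈uv with x∈p∪q⁻ _ _ z∈uv
    ...     | inj₁ z∈u = inj₁ (x∈⁅y⁆⇒x≡y _ z∈u)
    ...     | inj₂ z∈v = inj₂ (inj₁ (x∈⁅y⁆⇒x≡y _ z∈v))

    ∈-corners⁺ : ∀ {z} → Corner u v w x z → z ∈ corners u v w x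
    ∈-corners⁺ at-u = x∈p∪q⁺ (inj₁ (x∈p∪q⁺ (inj₁ (x∈p∪q⁺ (inj₁ (x∈⁅x⁆ u))))))
    ∈-corners⁺ at-v = x∈p∪q⁺ (inj₁ (x∈p∪q⁺ (inj₁ (x∈p∪q⁺ (inj₂ (x∈⁅x⁆ v))))))
    ∈-corners⁺ at-w = x∈p∪q⁺ (inj₁ (x∈p∪q⁺ (inj₂ (x∈⁅x⁆ w))))
    ∈-corners⁺ at-x = x∈p∪q⁺ (inj₂ (x∈⁅x⁆ x))

    ∣corners∣ : ∀ {ℓ} {R : Rel (Fin n) ℓ} → K4⁻ R u v w x → 4 ≤ ∣ corners u v w x ∣
    ∣corners∣ k =
      ≤-trans (s≤s (≤-trans (s≤s (≤-trans (s≤s (subst (1 ≤_) (sym (∣⁅x⁆∣≡1 u)) ≤-refl))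
        (∣p∣<∣p∪⁅x⁆∣ (x≢y⇒x∉⁅y⁆ (u≢v ∘ sym)))))
        (∣p∣<∣p∪⁅x⁆∣ (∉-∪ (x≢y⇒x∉⁅y⁆ (u≢w ∘ sym)) (x≢y⇒x∉⁅y⁆ (v≢w ∘ sym))))))
        (∣p∣<∣p∪⁅x⁆∣ (∉-∪ (∉-∪ (x≢y⇒x∉⁅y⁆ (u≢x ∘ sym)) (x≢y⇒x∉⁅y⁆ (v≢x ∘ sym))) (x≢y⇒x∉⁅y⁆ (w≢x ∘ sym))))
      where open K4⁻ k

  record Attachment (F : Adj n) (K : Subset n) (Z : Pred (Fin n) 0ℓ) : Set where
    field
      {y a b} : Fin n
      y∈Z : Z y
      y∉K : y ∉ K
      a∈K : a ∈ K
      b∈K : b ∈ K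
      a≢b : a ≢ b
      ya  : Edge F y a
      yb  : Edge F y b

  attachment-⊆ : ∀ {F K} {Z Z′ : Pred (Fin n) 0ℓ} → Z ⊆ Z′ → Attachment F K Z → Attachment F K Z′
  attachment-⊆ Z⊆Z′ att = record { Attachment att; y∈Z = Z⊆Z′ (Attachment.y∈Z att) }

  module _ {F : Adj n} (F-sym : Symmetric (Edge F)) {K : Subset n} where

    attach-end-side : ∀ {u v w x} → K4⁻ (Edge F) u v w x → u ∈ K → w ∈ K → v ∉ K →
                      Attachment F K (Corner u v w x)
    attach-end-side {x = x} k u∈ w∈ v∉ with x ∈? K
    ... | yes x∈ = record { y∈Z = at-v ; y∉K = v∉ ; a∈K = w∈ ; b∈K = x∈ ; a≢b = w≢x ; ya = vw ; yb = vx }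
      where open K4⁻ k
    ... | no x∉  = record { y∈Z = at-x ; y∉K = x∉ ; a∈K = u∈ ; b∈K = w∈ ; a≢b = u≢w
                          ; ya = F-sym ux ; yb = F-sym wx }
      where open K4⁻ k

    attach-sides : ∀ {u v w x} → K4⁻ (Edge F) u v w x → w ∈ K → x ∈ K → ¬ (u ∈ K × v ∈ K) →
                   Attachment F K (Corner u v w x)
    attach-sides {u} k w∈ x∈ ¬uv with u ∈? K
    ... | no u∉  = record { y∈Z = at-u ; y∉K = u∉ ; a∈K = w∈ ; b∈K = x∈ ; a≢b = w≢x ; ya = uw ; yb = ux }
      where open K4⁻ k
    ... | yes u∈ = record { y∈Z = at-v ; y∉K = λ v∈ → ¬uv (u∈ , v∈) ; a∈K = w∈ ; b∈K = x∈
                          ; a≢b = w≢x ; ya = vw ; yb = vx }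
      where open K4⁻ k

    attachment : ∀ {u v w x p q} → K4⁻ (Edge F) u v w x → ¬ (u ∈ K × v ∈ K) →
                 Corner u v w x p → Corner u v w x q → p ≢ q → p ∈ K → q ∈ K →
                 Attachment F K (Corner u v w x)
    attachment {u} {v} {w} {x} k ¬uv = pair
      where
      Att : Set
      Att = Attachment F K (Corner u v w x)
      u-w : u ∈ K → w ∈ K → Att
      u-w u∈ w∈ = attach-end-side k u∈ w∈ (λ v∈ → ¬uv (u∈ , v∈))
      u-x : u ∈ K → x ∈ K → Att
      u-x u∈ x∈ = attachment-⊆ corner-swap-sides
        (attach-end-side (K4⁻-swap-sides F-sym k) u∈ x∈ (λ v∈ → ¬uv (u∈ , v∈)))
      v-w : v ∈ K → w ∈ K → Att
      v-w v∈ w∈ = attachment-⊆ corner-swap-ends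
        (attach-end-side (K4⁻-swap-ends k) v∈ w∈ (λ u∈ → ¬uv (u∈ , v∈)))
      v-x : v ∈ K → x ∈ K → Att
      v-x v∈ x∈ = attachment-⊆ (λ c → corner-swap-ends (corner-swap-sides c))
        (attach-end-side (K4⁻-swap-sides F-sym (K4⁻-swap-ends k)) v∈ x∈ (λ u∈ → ¬uv (u∈ , v∈)))
      pair : ∀ {p q} → Corner u v w x p → Corner u v w x q → p ≢ q → p ∈ K → q ∈ K → Att
      pair at-u at-u p≢q _ _ = ⊥-elim (p≢q refl)
      pair at-v at-v p≢q _ _ = ⊥-elim (p≢q refl)
      pair at-w at-w p≢q _ _ = ⊥-elim (p≢q refl)
      pair at-x at-x p≢q _ _ = ⊥-elim (p≢q refl)
      pair at-u at-v _ u∈ v∈ = ⊥-elim (¬uv (u∈ , v∈))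
      pair at-v at-u _ v∈ u∈ = ⊥-elim (¬uv (u∈ , v∈))
      pair at-u at-w _ u∈ w∈ = u-w u∈ w∈
      pair at-w at-u _ w∈ u∈ = u-w u∈ w∈
      pair at-u at-x _ u∈ x∈ = u-x u∈ x∈
      pair at-x at-u _ x∈ u∈ = u-x u∈ x∈
      pair at-v at-w _ v∈ w∈ = v-w v∈ w∈
      pair at-w at-v _ w∈ v∈ = v-w v∈ w∈
      pair at-v at-x _ v∈ x∈ = v-x v∈ x∈
      pair at-x at-v _ x∈ v∈ = v-x v∈ x∈
      pair at-w at-x _ w∈ x∈ = attach-sides k w∈ x∈ ¬uv
      pair at-x at-w _ x∈ w∈ = attach-sides k w∈ x∈ ¬uv

  record Certificate (t : ℕ) (u v : Fin n) : Set where
    field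
      core           : Subset n
      large          : suc t + 3 ≤ ∣ core ∣
      core-clique    : IsClique (iter E (suc t)) (_∈ core)
      closure-clique : IsClique (iter E (suc (suc t))) (_∈ core ∪ ⁅ u ⁆ ∪ ⁅ v ⁆)

  fresh-corners : ∀ {t u v w x} → K4⁻ (Edge (iter E (suc t))) u v w x → iter E (suc t) u v ≡ false →
                  ∃₂ λ p q → Corner u v w x p × Corner u v w x q × p ≢ q × Fresh E t p q
  fresh-corners k uv∉ with edge-or-fresh E uw | edge-or-fresh E ux | edge-or-fresh E vw
                         | edge-or-fresh E vx | edge-or-fresh E wx
    where open K4⁻ k
  ... | inj₂ f | _ | _ | _ | _ = _ , _ , at-u , at-w , K4⁻.u≢w k , f
  ... | inj₁ _ | inj₂ f | _ | _ | _ = _ , _ , at-u , at-x , K4⁻.u≢x k , f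
  ... | inj₁ _ | inj₁ _ | inj₂ f | _ | _ = _ , _ , at-v , at-w , K4⁻.v≢w k , f
  ... | inj₁ _ | inj₁ _ | inj₁ _ | inj₂ f | _ = _ , _ , at-v , at-x , K4⁻.v≢x k , f
  ... | inj₁ _ | inj₁ _ | inj₁ _ | inj₁ _ | inj₂ f = _ , _ , at-w , at-x , K4⁻.w≢x k , f
  ... | inj₁ e₁ | inj₁ e₂ | inj₁ e₃ | inj₁ e₄ | inj₁ e₅ =
    ⊥-elim (true≢false (K4⁻⇒step _ record { K4⁻ k ; uw = e₁ ; ux = e₂ ; vw = e₃ ; vx = e₄ ; wx = e₅ }) uv∉)

  module _ {t u v w x p q} (k : K4⁻ (Edge (iter E (suc t))) u v w x) (uv∉ : iter E (suc t) u v ≡ false)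
           (cp : Corner u v w x p) (cq : Corner u v w x q) (p≢q : p ≢ q) (cert : Certificate t p q) where

    open Certificate cert

    private
      F₁ F₂ : Adj n
      F₁ = iter E (suc t)
      F₂ = iter E (suc (suc t))

      F₁-sym : Symmetric (Edge F₁)
      F₁-sym = iter-sym E E-sym (suc t)

      L Z : Subset n
      L = core ∪ ⁅ p ⁆ ∪ ⁅ q ⁆
      Z = corners u v w x

      core⊆L : ∀ {z} → z ∈ core → z ∈ L
      core⊆L = p⊆p∪q _

      p∈L : p ∈ L
      p∈L = x∈p∪q⁺ (inj₂ (x∈p∪q⁺ (inj₁ (x∈⁅x⁆ p))))

      q∈L : q ∈ L
      q∈L = x∈p∪q⁺ (inj₂ (x∈p∪q⁺ (inj₂ (x∈⁅x⁆ q))))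

      L∪Z-clique : IsClique (step F₂) (λ z → z ∈ L ⊎ z ∈ Z)
      L∪Z-clique = clique-merge F₂ (iter-sym E E-sym (suc (suc t))) (_∈? L) (_∈? Z) closure-clique
        (clique-⊆ F₂ ∈-corners⁻ (K4⁻-clique F₁-sym k))
        p∈L (∈-corners⁺ cp) q∈L (∈-corners⁺ cq) p≢q

    enlarged-core : ∃[ K ] (core ⊂ K × (∀ {z} → z ∈ K → z ∈ L ⊎ z ∈ Z) × IsClique F₂ (_∈ K))
    enlarged-core with p ∈? core | q ∈? core
    ... | no p∉ | _     = L , (core⊆L , p , p∈L , p∉) , inj₁ , closure-clique
    ... | _     | no q∉ = L , (core⊆L , q , q∈L , q∉) , inj₁ , closure-clique
    ... | yes p∈ | yes q∈ =
      core ∪ ⁅ y ⁆ , (p⊆p∪q _ , y , x∈p∪q⁺ (inj₂ (x∈⁅x⁆ y)) , y∉K) , into-L∪Z , clique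
      where
      ¬uv : ¬ (u ∈ core × v ∈ core)
      ¬uv (u∈ , v∈) = true≢false (core-clique u∈ v∈ (K4⁻.u≢v k)) uv∉
      open Attachment (attachment F₁-sym k ¬uv cp cq p≢q p∈ q∈)
      split : ∀ {z} → z ∈ core ∪ ⁅ y ⁆ → z ≡ y ⊎ z ∈ core
      split {z} z∈ with x∈p∪q⁻ core _ z∈
      ... | inj₁ z∈K = inj₂ z∈K
      ... | inj₂ z∈y = inj₁ (x∈⁅y⁆⇒x≡y y z∈y)
      into-L∪Z : ∀ {z} → z ∈ core ∪ ⁅ y ⁆ → z ∈ L ⊎ z ∈ Z
      into-L∪Z z∈ with split z∈
      ... | inj₁ refl = inj₂ (∈-corners⁺ y∈Z)
      ... | inj₂ z∈K  = inj₁ (core⊆L z∈K)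
      clique : IsClique F₂ (_∈ core ∪ ⁅ y ⁆)
      clique = clique-⊆ F₂ split (clique-extend F₁ F₁-sym core-clique y∉K a∈K b∈K a≢b ya yb)

    certificate-step : Certificate (suc t) u v
    certificate-step with K , core⊂K , K⊆L∪Z , K-clique ← enlarged-core = record
      { core           = K
      ; large          = ≤-trans (s≤s large) (p⊂q⇒∣p∣<∣q∣ core⊂K)
      ; core-clique    = K-clique
      ; closure-clique = clique-⊆ (step F₂) (∪-pair-⊆ K⊆L∪Z (inj₂ (∈-corners⁺ at-u)) (inj₂ (∈-corners⁺ at-v))) L∪Z-clique
      }

  fresh⇒certificate : ∀ {t u v} → Fresh E t u v → Certificate t u v
  fresh⇒certificate {zero} {u} {v} f with w , x , k ← fresh⇒K4⁻ E f = record
    { core           = corners u v w x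
    ; large          = ∣corners∣ k
    ; core-clique    = Z-clique
    ; closure-clique = clique-⊆ (iter E 2) (∪-pair-⊆ (λ z∈ → z∈) (∈-corners⁺ at-u) (∈-corners⁺ at-v))
                         (clique-step (iter E 1) Z-clique)
    }
    where
    Z-clique : IsClique (iter E 1) (_∈ corners u v w x)
    Z-clique = clique-⊆ (iter E 1) ∈-corners⁻ (K4⁻-clique E-sym k)
  fresh⇒certificate {suc t} f
    with w , x , k ← fresh⇒K4⁻ E f
    with p , q , cp , cq , p≢q , f′ ← fresh-corners k (Fresh.old f)
    = certificate-step k (Fresh.old f) cp cq p≢q (fresh⇒certificate f′)

  fresh⇒vertex-bound : ∀ {t u v} → Fresh E t u v → suc t + 3 ≤ n
  fresh⇒vertex-bound f = let open Certificate (fresh⇒certificate f) in ≤-trans large (∣p∣≤n core)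

module DegreeTwo {P : Fin n → Bool} {L : List (Fin n)} (degree : length (filterᵇ P L) ≡ 2) where

  open import Data.List.Membership.Propositional using (_∈_)
  open import Data.List.Membership.Propositional.Properties using (∈-filter⁺; ∈-filter⁻)
  open import Data.List.Relation.Unary.Any using (here; there)
  open import Data.List.Relation.Unary.Unique.Propositional using (Unique)
  open import Data.List.Relation.Unary.Unique.Propositional.Properties using (filter⁺)
  open import Data.List.Relation.Unary.All using ([]; _∷_)
  open import Data.List.Relation.Unary.AllPairs using (_∷_)

  private
    length≡2 : ∀ (xs : List (Fin n)) → length xs ≡ 2 → ∃₂ λ p q → xs ≡ p ∷ q ∷ []
    length≡2 (p ∷ q ∷ []) refl = p , q , refl

    pair : ∃₂ λ p q → filterᵇ P L ≡ p ∷ q ∷ []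
    pair = length≡2 (filterᵇ P L) degree

    p q : Fin n
    p = proj₁ pair
    q = proj₁ (proj₂ pair)

    into-pair : ∀ {x} → x ∈ L → P x ≡ true → x ∈ p ∷ q ∷ []
    into-pair x∈ px = subst (_ ∈_) (proj₂ (proj₂ pair)) (∈-filter⁺ (T? ∘ P) x∈ (from T-≡ px))

    no-three-in-pair : ∀ {a b c} → a ∈ p ∷ q ∷ [] → b ∈ p ∷ q ∷ [] → c ∈ p ∷ q ∷ [] → a ≢ b → a ≢ c → b ≢ c → ⊥
    no-three-in-pair (here refl)         (here refl)         _                   a≢b _   _   = a≢b refl
    no-three-in-pair (there (here refl)) (there (here refl)) _                   a≢b _   _   = a≢b refl
    no-three-in-pair (here refl)         _                   (here refl)         _   a≢c _   = a≢c refl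
    no-three-in-pair (there (here refl)) _                   (there (here refl)) _   a≢c _   = a≢c refl
    no-three-in-pair _                   (here refl)         (here refl)         _   _   b≢c = b≢c refl
    no-three-in-pair _                   (there (here refl)) (there (here refl)) _   _   b≢c = b≢c refl

  no-three : ∀ {a b c} → a ≢ b → a ≢ c → b ≢ c → a ∈ L → b ∈ L → c ∈ L →
             P a ≡ true → P b ≡ true → P c ≡ true → ⊥
  no-three a≢b a≢c b≢c a∈ b∈ c∈ pa pb pc = no-three-in-pair (into-pair a∈ pa) (into-pair b∈ pb) (into-pair c∈ pc) a≢b a≢c b≢c

  only-two : ∀ {a b x} → a ≢ b → a ∈ L → b ∈ L → P a ≡ true → P b ≡ true → x ∈ L → P x ≡ true → x ≡ a ⊎ x ≡ b
  only-two {a} {b} {x} a≢b a∈ b∈ pa pb x∈ px with x ≟ a | x ≟ b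
  ... | yes x≡a | _       = inj₁ x≡a
  ... | no _    | yes x≡b = inj₂ x≡b
  ... | no x≢a  | no x≢b  = ⊥-elim (no-three a≢b (x≢a ∘ sym) (x≢b ∘ sym) a∈ b∈ x∈ pa pb px)

  non-neighbour : ∀ {a b c} → a ≢ b → a ≢ c → b ≢ c → a ∈ L → b ∈ L → c ∈ L → ∃[ x ] (x ∈ L × P x ≡ false)
  non-neighbour {a} {b} {c} a≢b a≢c b≢c a∈ b∈ c∈ with P a Bool.≟ true | P b Bool.≟ true | P c Bool.≟ true
  ... | no ¬pa | _      | _      = a , a∈ , ¬-not ¬pa
  ... | yes _  | no ¬pb | _      = b , b∈ , ¬-not ¬pb
  ... | yes _  | yes _  | no ¬pc = c , c∈ , ¬-not ¬pc
  ... | yes pa | yes pb | yes pc = ⊥-elim (no-three a≢b a≢c b≢c a∈ b∈ c∈ pa pb pc)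

  two-neighbours : Unique L → ∃₂ λ a b → a ≢ b × a ∈ L × b ∈ L × P a ≡ true × P b ≡ true
  two-neighbours unique = p , q , p≢q , proj₁ (out (here refl)) , proj₁ (out (there (here refl))) ,
                          to T-≡ (proj₂ (out (here refl))) , to T-≡ (proj₂ (out (there (here refl))))
    where
    out : ∀ {x} → x ∈ p ∷ q ∷ [] → x ∈ L × T (P x)
    out x∈ = ∈-filter⁻ (T? ∘ P) (subst (_ ∈_) (sym (proj₂ (proj₂ pair))) x∈)
    p≢q : p ≢ q
    p≢q with subst Unique (proj₂ (proj₂ pair)) (filter⁺ (T? ∘ P) unique)
    ... | (p≢q ∷ []) ∷ _ = p≢q

simple-sym : {E : Adj n} → IsSimpleGraph E → Symmetric (Edge E)
simple-sym simple {u} {v} e = trans (IsSimpleGraph.sym simple v u) e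

simple-loopless : {E : Adj n} → IsSimpleGraph E → ∀ {u v} → Edge E u v → u ≢ v
simple-loopless simple {u} e refl = true≢false e (IsSimpleGraph.irrefl simple u)

module Family {E : Adj n} (simple : IsSimpleGraph E) where

  open import Data.List.Membership.Propositional using (_∈_; _∉_)
  open import Data.List.Relation.Unary.Any using (here; there; toSum)
  open import Data.List.Relation.Unary.Unique.Propositional using (Unique)
  open import Data.List.Relation.Unary.All using ([]; _∷_)
  open import Data.List.Relation.Unary.AllPairs using ([]; _∷_)

  private
    E-sym : Symmetric (Edge E)
    E-sym = simple-sym simple

  IsH-length : ∀ {k M} → IsH E k M → length M ≡ k + 3
  IsH-length (body _ _ _ _ _ _ _ _ _)  = refl
  IsH-length (first _ _ d _ _)         = cong suc (IsH-length d)
  IsH-length (next _ _ _ _ d _ _ _ _)  = cong suc (IsH-length d)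

  IsH-tail : ∀ {k v L} → IsH E (suc k) (v ∷ L) → IsH E k L
  IsH-tail (first _ _ d _ _)        = d
  IsH-tail (next _ _ _ _ d _ _ _ _) = d

  IsH-degree : ∀ {k v L} → IsH E (suc k) (v ∷ L) → nbrCount E v L ≡ 2
  IsH-degree (first _ _ _ _ deg)        = deg
  IsH-degree (next _ _ _ _ _ _ _ deg _) = deg

  IsH-head∉tail : ∀ {k v L} → IsH E k (v ∷ L) → v ∉ L
  IsH-head∉tail (body _ _ _ _ b≢c _   _ _ _) (here c≡b)         = ≠ᵇ⇒≢ b≢c (sym c≡b)
  IsH-head∉tail (body _ _ _ _ _   a≢c _ _ _) (there (here c≡a)) = ≠ᵇ⇒≢ a≢c (sym c≡a)
  IsH-head∉tail (first _ _ _ v∉ _)        = v∉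
  IsH-head∉tail (next _ _ _ _ _ v∉ _ _ _) = v∉

  IsH-three : ∀ {k M} → IsH E k M → ∃[ a ] ∃[ b ] ∃[ c ] (a ≢ b × a ≢ c × b ≢ c × a ∈ M × b ∈ M × c ∈ M)
  IsH-three (body a b c a≢b b≢c a≢c _ _ _) =
    a , b , c , ≠ᵇ⇒≢ a≢b , ≠ᵇ⇒≢ a≢c , ≠ᵇ⇒≢ b≢c , there (there (here refl)) , there (here refl) , here refl
  IsH-three {suc k} {v ∷ L} d =
    let a , b , c , a≢b , a≢c , b≢c , a∈ , b∈ , c∈ = IsH-three (IsH-tail d)
    in a , b , c , a≢b , a≢c , b≢c , there a∈ , there b∈ , there c∈

  IsH₀-unique : ∀ {L} → IsH E 0 L → Unique L
  IsH₀-unique (body _ _ _ a≢b b≢c a≢c _ _ _) =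
    (≠ᵇ⇒≢ b≢c ∘ sym ∷ ≠ᵇ⇒≢ a≢c ∘ sym ∷ []) ∷ (≠ᵇ⇒≢ a≢b ∘ sym ∷ []) ∷ [] ∷ []

  cons-clique : ∀ {F : Adj n} {y L} → IsClique F (λ z → z ≡ y ⊎ z ∈ L) → IsClique F (_∈ y ∷ L)
  cons-clique {F} = clique-⊆ F toSum

  IsH-clique : ∀ {k M} → IsH E k M → IsClique (iter E k) (_∈ M)
  IsH-clique (body a b c _ _ _ ab bc ac) =
    cons-clique (clique-insert E E-sym (cons-clique (clique-insert E E-sym a-clique λ { (here refl) _ → E-sym ab }))
      λ { (here refl) _ → E-sym bc ; (there (here refl)) _ → E-sym ac })
    where
    a-clique : IsClique E (_∈ a ∷ [])
    a-clique (here refl) (here refl) a≢a = ⊥-elim (a≢a refl)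
  IsH-clique (first v L d v∉ deg) =
    let a , b , a≢b , a∈ , b∈ , va , vb = DegreeTwo.two-neighbours {P = E v} {L} deg (IsH₀-unique d)
    in cons-clique (clique-extend E E-sym (IsH-clique d) v∉ a∈ b∈ a≢b va vb)
  IsH-clique (next t v u L d v∉ vu deg (w , w∈ , vw , _)) =
    cons-clique (clique-extend (iter E (suc t)) (iter-sym E E-sym (suc t)) (IsH-clique d) v∉ (here refl) (there w∈)
      (λ { refl → IsH-head∉tail d w∈ }) (iter-mono E {0} {suc t} z≤n vu) (iter-mono E {0} {suc t} z≤n vw))

  -- For M = v_k ∷ … ∷ v_1 ∷ V₀, layer k M s is V_s = V₀ ∪ {v_j : j ≤ s}; the case of an empty list is junk.
  layer : ℕ → List (Fin n) → ℕ → Pred (Fin n) 0ℓ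
  layer zero    M       s x = x ∈ M
  layer (suc k) []      s x = ⊥
  layer (suc k) (v ∷ L) s x = (suc k ≤ s × x ≡ v) ⊎ layer k L s x

  layer⊆ : ∀ k {M s x} → layer k M s x → x ∈ M
  layer⊆ zero    x∈              = x∈
  layer⊆ (suc k) {v ∷ L} (inj₁ (_ , refl)) = here refl
  layer⊆ (suc k) {v ∷ L} (inj₂ x∈) = there (layer⊆ k x∈)

  layer-mono : ∀ k {M s s′ x} → s ≤ s′ → layer k M s x → layer k M s′ x
  layer-mono zero    s≤s′ x∈ = x∈
  layer-mono (suc k) {v ∷ L} s≤s′ (inj₁ (k<s , x≡v)) = inj₁ (≤-trans k<s s≤s′ , x≡v)
  layer-mono (suc k) {v ∷ L} s≤s′ (inj₂ x∈)          = inj₂ (layer-mono k s≤s′ x∈)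

  layer-full : ∀ k {M s x} → k ≤ s → x ∈ M → layer k M s x
  layer-full zero    k≤s x∈ = x∈
  layer-full (suc k) {v ∷ L} k<s (here refl) = inj₁ (k<s , refl)
  layer-full (suc k) {v ∷ L} k<s (there x∈) = inj₂ (layer-full k (≤-trans (n≤1+n k) k<s) x∈)

  layer-below : ∀ {k v L s x} → s < suc k → layer (suc k) (v ∷ L) s x → layer k L s x
  layer-below s<1+k (inj₁ (k<s , _)) = ⊥-elim (<-irrefl refl (≤-trans k<s (≤-pred s<1+k)))
  layer-below s<1+k (inj₂ x∈)        = x∈

  head∉layer : ∀ {k v L s} → v ∉ L → s < suc k → ¬ layer (suc k) (v ∷ L) s v
  head∉layer {k} v∉ s<1+k v∈ = v∉ (layer⊆ k (layer-below s<1+k v∈))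

  Envelope : ℕ → List (Fin n) → ℕ → Rel (Fin n) 0ℓ
  Envelope k M s a b = Edge E a b ⊎ (layer k M s a × layer k M s b)

  envelope-sym : ∀ {k M s} → Symmetric (Envelope k M s)
  envelope-sym (inj₁ e)          = inj₁ (E-sym e)
  envelope-sym (inj₂ (a∈ , b∈))  = inj₂ (b∈ , a∈)

  CompletesInLayer : ℕ → List (Fin n) → ℕ → Set
  CompletesInLayer k M s = ∀ {p q y z} → (∀ {x} → Corner p q y z x → x ∈ M) →
                           K4⁻ (Envelope k M s) p q y z → layer k M (suc s) p × layer k M (suc s) q

  module NewVertex {t v u w L} (d : IsH E (suc t) (u ∷ L)) (v∉ : v ∉ u ∷ L) (v∼u : Edge E v u)
                   (deg : nbrCount E v (u ∷ L) ≡ 2) (w∈ : w ∈ L) (v∼w : Edge E v w) (uw∉E : E u w ≡ false)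
                   {s} (s<1+t : s < suc t) where

    private
      M : List (Fin n)
      M = v ∷ u ∷ L
      Env : Rel (Fin n) 0ℓ
      Env = Envelope (suc (suc t)) M s
      s<2+t : s < suc (suc t)
      s<2+t = ≤-trans s<1+t (n≤1+n (suc t))
      env-sym : Symmetric Env
      env-sym = envelope-sym {suc (suc t)} {M} {s}
      open DegreeTwo {P = E v} {u ∷ L} deg

    neighbours-distinct : u ≢ w
    neighbours-distinct refl = IsH-head∉tail d w∈

    into-tail : ∀ {x} → x ∈ M → x ≢ v → x ∈ u ∷ L
    into-tail (here x≡v) x≢v = ⊥-elim (x≢v x≡v)
    into-tail (there x∈) _   = x∈

    lower : ∀ {a b} → Env a b → Envelope (suc t) (u ∷ L) s a b
    lower (inj₁ e)          = inj₁ e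
    lower (inj₂ (a∈ , b∈))  = inj₂ (layer-below s<2+t a∈ , layer-below s<2+t b∈)

    from-v : ∀ {a} → Env v a → Edge E v a
    from-v (inj₁ e)      = e
    from-v (inj₂ (v∈ , _)) = ⊥-elim (head∉layer v∉ s<2+t v∈)

    neighbour : ∀ {a} → a ∈ M → Edge E v a → a ≡ u ⊎ a ≡ w
    neighbour a∈ va = only-two neighbours-distinct (here refl) (there w∈) v∼u v∼w (into-tail a∈ (simple-loopless simple va ∘ sym)) va

    ¬env-uw : ¬ Env u w
    ¬env-uw (inj₁ e)        = true≢false e uw∉E
    ¬env-uw (inj₂ (u∈ , _)) = head∉layer (IsH-head∉tail d) s<1+t (layer-below s<2+t u∈)

    -- v cannot be an end of the missing edge: its other two corners would be u and w, which are not adjacent in Env.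
    not-end : ∀ {q y z} → (∀ {x} → Corner v q y z x → x ∈ M) → ¬ K4⁻ Env v q y z
    not-end in-M k with neighbour (in-M at-w) (from-v uw) | neighbour (in-M at-x) (from-v ux)
      where open K4⁻ k
    ... | inj₁ refl | inj₁ refl = K4⁻.w≢x k refl
    ... | inj₂ refl | inj₂ refl = K4⁻.w≢x k refl
    ... | inj₁ refl | inj₂ refl = ¬env-uw (K4⁻.wx k)
    ... | inj₂ refl | inj₁ refl = ¬env-uw (env-sym (K4⁻.wx k))

    not-side : ∀ {p q z} → (∀ {x} → Corner p q v z x → x ∈ M) → ¬ K4⁻ Env p q v z
    not-side in-M k = no-three u≢v u≢x v≢x
      (into-tail (in-M at-u) u≢w) (into-tail (in-M at-v) v≢w) (into-tail (in-M at-x) (w≢x ∘ sym))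
      (from-v (env-sym uw)) (from-v (env-sym vw)) (from-v wx)
      where open K4⁻ k

    completes-in-layer : CompletesInLayer (suc t) (u ∷ L) s → CompletesInLayer (suc (suc t)) M s
    completes-in-layer closed-tail {p} {q} {y} {z} in-M k with v ≟ p | v ≟ q | v ≟ y | v ≟ z
    ... | yes refl | _        | _        | _        = ⊥-elim (not-end in-M k)
    ... | no _     | yes refl | _        | _        = ⊥-elim (not-end (in-M ∘ corner-swap-ends) (K4⁻-swap-ends k))
    ... | no _     | no _     | yes refl | _        = ⊥-elim (not-side in-M k)
    ... | no _     | no _     | no _     | yes refl = ⊥-elim (not-side (in-M ∘ corner-swap-sides) (K4⁻-swap-sides env-sym k))
    ... | no v≢p   | no v≢q   | no v≢y   | no v≢z   =
      let p∈ , q∈ = closed-tail in-tail (K4⁻-map lower k) in inj₂ p∈ , inj₂ q∈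
      where
      in-tail : ∀ {x} → Corner p q y z x → x ∈ u ∷ L
      in-tail c@at-u = into-tail (in-M c) (v≢p ∘ sym)
      in-tail c@at-v = into-tail (in-M c) (v≢q ∘ sym)
      in-tail c@at-w = into-tail (in-M c) (v≢y ∘ sym)
      in-tail c@at-x = into-tail (in-M c) (v≢z ∘ sym)

  envelope-closed : ∀ {k M s} → IsH E k M → CompletesInLayer k M s
  envelope-closed (body _ _ _ _ _ _ _ _ _) in-M _ = in-M at-u , in-M at-v
  envelope-closed (first _ _ _ _ _) in-M _ =
    layer-full 1 (s≤s z≤n) (in-M at-u) , layer-full 1 (s≤s z≤n) (in-M at-v)
  envelope-closed {s = s} (next t v u L d v∉ v∼u deg (w , w∈ , v∼w , uw∉E)) in-M k with suc (suc t) ≤? suc s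
  ... | yes 2+t≤1+s = layer-full _ 2+t≤1+s (in-M at-u) , layer-full _ 2+t≤1+s (in-M at-v)
  ... | no 2+t≰1+s  = NewVertex.completes-in-layer d v∉ v∼u deg w∈ v∼w uw∉E (≤-pred (≰⇒> 2+t≰1+s))
                        (envelope-closed d) in-M k

  module _ {k M} (d : IsH E k M) (cover : ∀ x → x ∈ M) where

    iter⊆envelope : ∀ s {a b} → Edge (iter E s) a b → Envelope k M s a b
    iter⊆envelope zero e = inj₁ e
    iter⊆envelope (suc s) e with step⇒ (iter E s) e
    ... | inj₁ e′ with iter⊆envelope s e′
    ...   | inj₁ e″         = inj₁ e″
    ...   | inj₂ (a∈ , b∈) = inj₂ (layer-mono k (n≤1+n s) a∈ , layer-mono k (n≤1+n s) b∈)
    iter⊆envelope (suc s) e | inj₂ (_ , _ , c) =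
      inj₂ (envelope-closed d (λ {x} _ → cover x) (K4⁻-map (iter⊆envelope s) c))

  head-fresh : ∀ {k v L} → IsH E (suc k) (v ∷ L) → (∀ x → x ∈ v ∷ L) → ∃[ p ] Fresh E k v p
  head-fresh {k} {v} {L} d cover =
    let a , b , c , a≢b , a≢c , b≢c , a∈ , b∈ , c∈ = IsH-three (IsH-tail d)
        p , p∈ , v≁p = DegreeTwo.non-neighbour {P = E v} {L} (IsH-degree d) a≢b a≢c b≢c a∈ b∈ c∈
        v≢p : v ≢ p
        v≢p v≡p = IsH-head∉tail d (subst (_∈ L) (sym v≡p) p∈)
    in p , fresh (IsH-clique d (here refl) (there p∈) v≢p) (old p∈ v≁p)
    where
    old : ∀ {p} → p ∈ L → E v p ≡ false → iter E k v p ≡ false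
    old {p} p∈ v≁p with iter E k v p Bool.≟ true
    ... | no ¬e = ¬-not ¬e
    ... | yes e with iter⊆envelope d cover k e
    ...   | inj₁ e′       = ⊥-elim (true≢false e′ v≁p)
    ...   | inj₂ (v∈ , _) = ⊥-elim (head∉layer (IsH-head∉tail d) ≤-refl v∈)

  IsH-saturation-time : ∀ {k M} → IsH E (suc k) M → (∀ x → x ∈ M) → SatTime E (suc k)
  IsH-saturation-time {k} {v ∷ L} d cover = saturated , minimal
    where
    saturated : SaturatedAt E (suc k)
    saturated s a b e = IsH-clique d (cover a) (cover b) (iter-loopless E (simple-loopless simple) s e)
    minimal : ∀ t′ → t′ < suc k → ¬ SaturatedAt E t′
    minimal t′ t′<1+k = fresh⇒unsaturated E (proj₂ (head-fresh d cover)) (≤-pred t′<1+k)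

module _ where

  open import Data.List.Membership.Propositional using (_∈_)
  open import Data.List.Relation.Unary.Any using (index)
  open import Data.List.Relation.Unary.Any.Properties using (lookup-index)
  open import Data.List using (lookup)
  open import Data.Fin.Properties using (injective⇒≤)

  covering-length : (M : List (Fin n)) → (∀ x → x ∈ M) → n ≤ length M
  covering-length M cover = injective⇒≤ {f = index ∘ cover} λ {x} {y} eq →
    trans (lookup-index (cover x)) (trans (cong (lookup M) eq) (sym (lookup-index (cover y))))

saturation-time-bound : (E : Adj n) → IsSimpleGraph E → 3 ≤ n → ∃[ t ] (SatTime E t × t ≤ n ∸ 3)
saturation-time-bound {n} E simple 3≤n = quiescent⇒saturation-time E quiet
  where
  quiet : Quiescent E (n ∸ 3)
  quiet u v f = <-irrefl refl (subst (λ m → suc m ≤ n) (m∸n+n≡m 3≤n) (CliqueGrowth.fresh⇒vertex-bound (simple-sym simple) f))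

saturation-time⇒vertex-bound : ∀ {t} (E : Adj n) → IsSimpleGraph E → SatTime E (suc t) → suc t + 3 ≤ n
saturation-time⇒vertex-bound E simple sat =
  let _ , _ , f = saturation-time⇒fresh E sat in CliqueGrowth.fresh⇒vertex-bound (simple-sym simple) f

family-size-and-time : ∀ {t} (H : Adj n) → IsSimpleGraph H → InFamilyH (suc t) H → (n ≡ suc t + 3) × SatTime H (suc t)
family-size-and-time {n} {t} H simple (M , d , cover) =
  ≤-antisym (subst (n ≤_) (IsH-length d) (covering-length M cover)) (saturation-time⇒vertex-bound H simple sat) , sat
  where
  open Family simple
  sat : SatTime H (suc t)
  sat = IsH-saturation-time d cover

theorem2 : ((n : ℕ) (E : Adj n) → IsSimpleGraph E → 3 ≤ n →
             ∃[ t ] (SatTime E t × t ≤ n ∸ 3))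
           ×
           ((t : ℕ) → 1 ≤ t →
             ((n : ℕ) (H : Adj n) → IsSimpleGraph H → InFamilyH t H →
               (n ≡ t + 3) × SatTime H t)
             ×
             ((n : ℕ) (G : Adj n) → IsSimpleGraph G → SatTime G t → t + 3 ≤ n))
theorem2 = (λ _ → saturation-time-bound) , λ where
  (suc t) _ → (λ _ → family-size-and-time) , (λ _ → saturation-time⇒vertex-bound)
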